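{- Let $G=(A\cup B,E)$ be a bipartite graph with color classes $A$ and $B$. Then the number of independent sets of $G$ is congruent modulo $2$ to $|\{X\subseteq A: N(X)=B\}|$.
   Context: $N(X)$ denotes the set of vertices adjacent to at least one vertex of $X$. Independent sets include the empty set. -}

module Defs where

open import Data.Nat using (ℕ; zero; suc; _+_; _%_)
open import Data.Bool using (Bool; true; false; _∧_; _∨_; not; if_then_else_)
open import Data.Fin using (Fin)
open import Data.Fin.Subset using (Subset; _∈_)
open import Data.Vec using (Vec; []; _∷_; lookup)
open import Data.List using (List; []; _∷_; map; _++_; length; filter)
open import Data.Product using (_×_; _,_; ∃-syntax)
open import Relation.Nullary using (¬_)
open import Relation.Unary using (Decidable)

-- A finite bipartite graph with colour classes A = Fin a and B = Fin b.
-- Its vertex set is A ⊎ B; edges only go between A and B and are given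
-- by the (Boolean, hence decidable) adjacency relation adj.
record BipartiteGraph : Set where
  field
    a   : ℕ
    b   : ℕ
    adj : Fin a → Fin b → Bool

Adj : (G : BipartiteGraph) → Fin (BipartiteGraph.a G) → Fin (BipartiteGraph.b G) → Set
Adj G i j = BipartiteGraph.adj G i j ≡ᵇ true
  where
  open import Relation.Binary.PropositionalEquality renaming (_≡_ to _≡ᵇ_)

allSubsets : (n : ℕ) → List (Subset n)
allSubsets zero = [] ∷ []
allSubsets (suc n) = map (true ∷_) (allSubsets n) ++ map (false ∷_) (allSubsets n)

-- A subset of the vertex set A ∪ B is a pair (X , Y) with X ⊆ A, Y ⊆ B.
-- It is independent iff no edge joins two of its vertices; as G is
-- bipartite, that means no edge between a vertex of X and one of Y.
IsIndependent : (G : BipartiteGraph) →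
  Subset (BipartiteGraph.a G) × Subset (BipartiteGraph.b G) → Set
IsIndependent G (X , Y) = ∀ i j → i ∈ X → j ∈ Y → ¬ Adj G i j

-- N(X) = B for X ⊆ A: every vertex of B has a neighbour in X
-- (N(X) ⊆ B automatically, since G is bipartite).
NeighbourhoodIsB : (G : BipartiteGraph) → Subset (BipartiteGraph.a G) → Set
NeighbourhoodIsB G X = ∀ j → ∃[ i ] (i ∈ X × Adj G i j)

count : {A : Set} {P : A → Set} → Decidable P → List A → ℕ
count P? xs = length (filter P? xs)

allVertexSubsets : (G : BipartiteGraph) →
  List (Subset (BipartiteGraph.a G) × Subset (BipartiteGraph.b G))
allVertexSubsets G =
  Data.List.concatMap (λ X → map (X ,_) (allSubsets (BipartiteGraph.b G)))
                      (allSubsets (BipartiteGraph.a G))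
  where import Data.List

open import Relation.Nullary using (Dec; yes; no; ¬?)
open import Relation.Nullary.Decidable using (_×-dec_; _→-dec_)
open import Data.Fin.Subset.Properties using (_∈?_)
open import Data.Fin.Properties using (all?; any?)
open import Data.Bool.Properties using () renaming (_≟_ to _≟ᵇ_)

Adj? : (G : BipartiteGraph) → ∀ i j → Dec (Adj G i j)
Adj? G i j = BipartiteGraph.adj G i j ≟ᵇ true

independent? : (G : BipartiteGraph) → Decidable (IsIndependent G)
independent? G (X , Y) =
  all? λ i → all? λ j → (i ∈? X) →-dec ((j ∈? Y) →-dec ¬? (Adj? G i j))

neighbourhoodIsB? : (G : BipartiteGraph) → Decidable (NeighbourhoodIsB G)
neighbourhoodIsB? G X = all? λ j → any? λ i → (i ∈? X) ×-dec Adj? G i j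

numIndependentSets : BipartiteGraph → ℕ
numIndependentSets G = count (independent? G) (allVertexSubsets G)

numCoveringSubsetsOfA : BipartiteGraph → ℕ
numCoveringSubsetsOfA G = count (neighbourhoodIsB? G) (allSubsets (BipartiteGraph.a G))

module Submission where

-- Group the independent sets (X , Y) of G = (A ∪ B, E) by their part X ⊆ A.
-- For fixed X, the pair (X , Y) is independent exactly when Y avoids the
-- neighbourhood N(X), so the group has 2^|B ∖ N(X)| elements.  That number
-- is odd iff B ∖ N(X) is empty, i.e. iff N(X) = B.  Summing over X gives
--   #independent sets ≡ #{X ⊆ A : N(X) = B}   (mod 2).

open import Defs
open import Data.Nat using (ℕ; zero; suc; _+_; _*_; _%_)
open import Data.Nat.Properties using (+-identityʳ; *-comm)
open import Data.Nat.DivMod using (%-distribˡ-+; m*n%n≡0)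
open import Data.Nat.ListAction using (sum)
open import Data.Bool using (true; false)
open import Data.Fin using (Fin; zero; suc)
open import Data.Fin.Subset using (Subset; _∈_)
open import Data.Fin.Subset.Properties using (_∈?_)
open import Data.Fin.Properties using (all?; any?)
open import Data.Vec using ([]; _∷_; here; there)
open import Data.List using (List; []; _∷_; map; _++_; length; filter; concatMap)
open import Data.List.Properties using (length-++; filter-++; filter-≐; filter-none)
open import Data.List.Relation.Unary.All using (universal)
open import Data.Product using (_×_; _,_; ∃-syntax)
open import Data.Empty using (⊥-elim)
open import Relation.Nullary using (¬_; Dec; yes; no)
open import Relation.Nullary.Decidable using (_×-dec_; _→-dec_; ¬?)
open import Level using (0ℓ)
open import Relation.Unary using (Pred; Decidable; _≐_)
open import Relation.Binary.PropositionalEquality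
  using (_≡_; refl; trans; cong; cong₂; module ≡-Reasoning)
open ≡-Reasoning

indicator : {P : Set} → Dec P → ℕ
indicator (yes _) = 1
indicator (no _)  = 0

indicator-no : {P : Set} (p? : Dec P) → ¬ P → indicator p? ≡ 0
indicator-no (yes p) ¬p = ⊥-elim (¬p p)
indicator-no (no _)  _  = refl

indicator-cong : {P Q : Set} (p? : Dec P) (q? : Dec Q) →
  (P → Q) → (Q → P) → indicator p? ≡ indicator q?
indicator-cong (yes _) (yes _) _   _   = refl
indicator-cong (yes p) (no ¬q) p→q _   = ⊥-elim (¬q (p→q p))
indicator-cong (no ¬p) (yes q) _   q→p = ⊥-elim (¬p (q→p q))
indicator-cong (no _)  (no _)  _   _   = refl

module Counting {A : Set} {P : Pred A 0ℓ} (P? : Decidable P) where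

  count-∷ : (x : A) (xs : List A) → count P? (x ∷ xs) ≡ indicator (P? x) + count P? xs
  count-∷ x xs with P? x
  ... | yes _ = refl
  ... | no _  = refl

  count-++ : (xs ys : List A) → count P? (xs ++ ys) ≡ count P? xs + count P? ys
  count-++ xs ys = trans (cong length (filter-++ P? xs ys)) (length-++ (filter P? xs))

  count-none : (∀ x → ¬ P x) → (xs : List A) → count P? xs ≡ 0
  count-none ¬P xs = cong length (filter-none P? (universal ¬P xs))

  count-≐ : {Q : Pred A 0ℓ} (Q? : Decidable Q) → P ≐ Q → (xs : List A) →
    count P? xs ≡ count Q? xs
  count-≐ Q? P≐Q xs = cong length (filter-≐ P? Q? P≐Q xs)

  count-as-sum : (xs : List A) → count P? xs ≡ sum (map (λ x → indicator (P? x)) xs)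
  count-as-sum []       = refl
  count-as-sum (x ∷ xs) = trans (count-∷ x xs) (cong (indicator (P? x) +_) (count-as-sum xs))

open Counting

count-map : {A B : Set} {P : Pred B 0ℓ} (P? : Decidable P) (f : A → B) (xs : List A) →
  count P? (map f xs) ≡ count (λ x → P? (f x)) xs
count-map P? f []       = refl
count-map P? f (x ∷ xs) with P? (f x)
... | yes _ = cong suc (count-map P? f xs)
... | no _  = count-map P? f xs

count-concatMap : {A B : Set} {P : Pred B 0ℓ} (P? : Decidable P)
  (blocks : A → List B) (xs : List A) →
  count P? (concatMap blocks xs) ≡ sum (map (λ x → count P? (blocks x)) xs)
count-concatMap P? blocks []       = refl
count-concatMap P? blocks (x ∷ xs) =
  trans (count-++ P? (blocks x) (concatMap blocks xs))
        (cong (count P? (blocks x) +_) (count-concatMap P? blocks xs))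

sum-cong-mod2 : {A : Set} (f g : A → ℕ) → (∀ x → f x % 2 ≡ g x % 2) →
  (xs : List A) → sum (map f xs) % 2 ≡ sum (map g xs) % 2
sum-cong-mod2 f g f≡g []       = refl
sum-cong-mod2 f g f≡g (x ∷ xs) = begin
  (f x + sum (map f xs)) % 2                ≡⟨ %-distribˡ-+ (f x) (sum (map f xs)) 2 ⟩
  (f x % 2 + sum (map f xs) % 2) % 2        ≡⟨ cong₂ (λ u v → (u + v) % 2) (f≡g x) (sum-cong-mod2 f g f≡g xs) ⟩
  (g x % 2 + sum (map g xs) % 2) % 2        ≡⟨ %-distribˡ-+ (g x) (sum (map g xs)) 2 ⟨
  (g x + sum (map g xs)) % 2                ∎

double-even : (c : ℕ) → (c + c) % 2 ≡ 0
double-even c = begin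
  (c + c) % 2       ≡⟨ cong (λ k → (c + k) % 2) (+-identityʳ c) ⟨
  (c + (c + 0)) % 2 ≡⟨ cong (_% 2) (*-comm 2 c) ⟩
  (c * 2) % 2       ≡⟨ m*n%n≡0 c 2 ⟩
  0                 ∎

Avoids : {n : ℕ} → Pred (Fin n) 0ℓ → Pred (Subset n) 0ℓ
Avoids Q Y = ∀ j → j ∈ Y → ¬ Q j

avoids? : {n : ℕ} {Q : Pred (Fin n) 0ℓ} → Decidable Q → Decidable (Avoids Q)
avoids? Q? Y = all? λ j → (j ∈? Y) →-dec ¬? (Q? j)

module _ {n : ℕ} {Q : Pred (Fin (suc n)) 0ℓ} where

  avoids-false : (λ Y → Avoids Q (false ∷ Y)) ≐ Avoids (λ j → Q (suc j))
  avoids-false = (λ avoid j j∈Y → avoid (suc j) (there j∈Y))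
               , (λ { avoid zero () ; avoid (suc j) (there j∈Y) → avoid j j∈Y })

  avoids-true : ¬ Q zero → (λ Y → Avoids Q (true ∷ Y)) ≐ Avoids (λ j → Q (suc j))
  avoids-true ¬Q₀ = (λ avoid j j∈Y → avoid (suc j) (there j∈Y))
                  , (λ { avoid zero here → ¬Q₀ ; avoid (suc j) (there j∈Y) → avoid j j∈Y })

  avoids-true-blocked : Q zero → ∀ Y → ¬ Avoids Q (true ∷ Y)
  avoids-true-blocked Q₀ Y avoid = avoid zero here Q₀

-- Key fact: the number of subsets of Fin n avoiding Q is odd iff Q holds
-- everywhere (it equals 2^|{j : ¬ Q j}|).
avoiding-subsets-parity : (n : ℕ) {Q : Pred (Fin n) 0ℓ} (Q? : Decidable Q) →
  count (avoids? Q?) (allSubsets n) % 2 ≡ indicator (all? Q?) % 2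
avoiding-subsets-parity zero    Q? =
  cong (_% 2) (indicator-cong (avoids? Q? []) (all? Q?) (λ _ ()) (λ _ _ ()))
avoiding-subsets-parity (suc n) {Q} Q? = begin
  count (avoids? Q?) (map (true ∷_) S ++ map (false ∷_) S) % 2
    ≡⟨ cong (_% 2) (count-++ (avoids? Q?) (map (true ∷_) S) (map (false ∷_) S)) ⟩
  (count (avoids? Q?) (map (true ∷_) S) + count (avoids? Q?) (map (false ∷_) S)) % 2
    ≡⟨ cong₂ (λ u v → (u + v) % 2) (count-map (avoids? Q?) (true ∷_) S) withoutFirst ⟩
  (count (λ Y → avoids? Q? (true ∷ Y)) S + count (avoids? Q′?) S) % 2
    ≡⟨ splitOnFirst (Q? zero) ⟩
  indicator (all? Q?) % 2 ∎
  where
  S = allSubsets n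
  Q′? : Decidable (λ j → Q (suc j))
  Q′? j = Q? (suc j)

  withoutFirst : count (avoids? Q?) (map (false ∷_) S) ≡ count (avoids? Q′?) S
  withoutFirst = trans (count-map (avoids? Q?) (false ∷_) S)
                       (count-≐ (λ Y → avoids? Q? (false ∷ Y)) (avoids? Q′?) avoids-false S)

  -- Subsets containing 0: none avoid Q if Q 0 holds; otherwise they are a
  -- second copy of the tail count, which cancels mod 2.
  splitOnFirst : Dec (Q zero) →
    (count (λ Y → avoids? Q? (true ∷ Y)) S + count (avoids? Q′?) S) % 2 ≡ indicator (all? Q?) % 2
  splitOnFirst (yes Q₀) = begin
    (count (λ Y → avoids? Q? (true ∷ Y)) S + count (avoids? Q′?) S) % 2
      ≡⟨ cong (λ u → (u + count (avoids? Q′?) S) % 2)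
              (count-none (λ Y → avoids? Q? (true ∷ Y)) (avoids-true-blocked Q₀) S) ⟩
    count (avoids? Q′?) S % 2
      ≡⟨ avoiding-subsets-parity n Q′? ⟩
    indicator (all? Q′?) % 2
      ≡⟨ cong (_% 2) (indicator-cong (all? Q′?) (all? Q?)
                       (λ { all′ zero → Q₀ ; all′ (suc j) → all′ j }) (λ all j → all (suc j))) ⟩
    indicator (all? Q?) % 2 ∎
  splitOnFirst (no ¬Q₀) = begin
    (count (λ Y → avoids? Q? (true ∷ Y)) S + count (avoids? Q′?) S) % 2
      ≡⟨ cong (λ u → (u + count (avoids? Q′?) S) % 2)
              (count-≐ (λ Y → avoids? Q? (true ∷ Y)) (avoids? Q′?) (avoids-true ¬Q₀) S) ⟩
    (count (avoids? Q′?) S + count (avoids? Q′?) S) % 2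
      ≡⟨ double-even (count (avoids? Q′?) S) ⟩
    0
      ≡⟨ cong (_% 2) (indicator-no (all? Q?) (λ all → ¬Q₀ (all zero))) ⟨
    indicator (all? Q?) % 2 ∎

module _ (G : BipartiteGraph) where
  open BipartiteGraph G

  Covered : Subset a → Pred (Fin b) 0ℓ
  Covered X j = ∃[ i ] (i ∈ X × Adj G i j)

  -- Its decider is chosen so that `all? (covered? X)` is literally
  -- `neighbourhoodIsB? G X`, i.e. N(X) = B means every j is covered.
  covered? : (X : Subset a) → Decidable (Covered X)
  covered? X j = any? λ i → (i ∈? X) ×-dec Adj? G i j

  independent⇔avoids : (X : Subset a) →
    (λ Y → IsIndependent G (X , Y)) ≐ Avoids (Covered X)
  independent⇔avoids X = (λ indep j j∈Y (i , i∈X , adj) → indep i j i∈X j∈Y adj)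
                       , (λ avoid i j i∈X j∈Y adj → avoid j j∈Y (i , i∈X , adj))

  independent-with-parity : (X : Subset a) →
    count (independent? G) (map (X ,_) (allSubsets b)) % 2
      ≡ indicator (neighbourhoodIsB? G X) % 2
  independent-with-parity X = begin
    count (independent? G) (map (X ,_) (allSubsets b)) % 2
      ≡⟨ cong (_% 2) (count-map (independent? G) (X ,_) (allSubsets b)) ⟩
    count (λ Y → independent? G (X , Y)) (allSubsets b) % 2
      ≡⟨ cong (_% 2) (count-≐ (λ Y → independent? G (X , Y)) (avoids? (covered? X))
                               (independent⇔avoids X) (allSubsets b)) ⟩
    count (avoids? (covered? X)) (allSubsets b) % 2
      ≡⟨ avoiding-subsets-parity b (covered? X) ⟩
    indicator (neighbourhoodIsB? G X) % 2 ∎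

lemma15 : (G : BipartiteGraph) →
          numIndependentSets G % 2 ≡ numCoveringSubsetsOfA G % 2
lemma15 G = begin
  numIndependentSets G % 2
    ≡⟨ cong (_% 2) (count-concatMap (independent? G) pairsWith As) ⟩
  sum (map (λ X → count (independent? G) (pairsWith X)) As) % 2
    ≡⟨ sum-cong-mod2 _ _ (independent-with-parity G) As ⟩
  sum (map (λ X → indicator (neighbourhoodIsB? G X)) As) % 2
    ≡⟨ cong (_% 2) (count-as-sum (neighbourhoodIsB? G) As) ⟨
  numCoveringSubsetsOfA G % 2 ∎
  where
  open BipartiteGraph G
  As = allSubsets a
  pairsWith : Subset a → List (Subset a × Subset b)
  pairsWith X = map (X ,_) (allSubsets b)
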